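{- For every integer $n\geq 130$ and every $h\in\mathbb{N}$ with $h\leq\binom{n}{3}$, there is a graph $G$ on $n+1$ vertices such that $\mathrm{sub}(K_3,G)=h$.
   Context: $K_3$ is the triangle. $\mathrm{sub}(F,G)$ is the number of subgraphs $G'\subseteq G$ with $G'\cong F$. -}

module Defs where

open import Data.Nat using (ℕ; _<_)
open import Data.Nat.Properties using (_<?_)
open import Data.Bool using (Bool; true; false; _∧_; if_then_else_)
open import Data.Fin using (Fin; toℕ)
open import Data.List using (List; allFin; filter; length; cartesianProduct; map; concatMap; [_]; [])
open import Data.Product using (_×_; _,_)
open import Relation.Binary.PropositionalEquality using (_≡_)
open import Relation.Nullary.Decidable using (does)

record Graph (m : ℕ) : Set where
  field
    adj   : Fin m → Fin m → Bool
    sym   : ∀ i j → adj i j ≡ adj j i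
    irrefl : ∀ i → adj i i ≡ false
open Graph public

triples : (m : ℕ) → List (Fin m × Fin m × Fin m)
triples m =
  concatMap (λ i → concatMap (λ j → concatMap (λ k →
    if does (toℕ i <? toℕ j) ∧ does (toℕ j <? toℕ k)
    then [ (i , j , k) ] else []) (allFin m)) (allFin m)) (allFin m)

isTriangle : ∀ {m} → Graph m → Fin m × Fin m × Fin m → Bool
isTriangle G (i , j , k) = adj G i j ∧ adj G j k ∧ adj G i k

-- sub(K₃, G): the number of subgraphs of G isomorphic to K₃. Such a subgraph
-- is determined by its 3-element vertex set, which must be pairwise adjacent.
subK3 : ∀ {m} → Graph m → ℕ
subK3 {m} G = length (filter (λ t → isTriangle G t ≡? true) (triples m))
  where
  open import Data.Bool.Properties using () renaming (_≟_ to _≡?_)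

{-# OPTIONS --safe #-}
-- Write h = C(K,3) + r with K ≤ n − 1 and r ≤ C(K,2), and start from the clique on K vertices.
-- A new vertex joined to c clique vertices adds C(c,2) triangles; two adjacent new vertices joined
-- to a and b clique vertices, s of them common, add s + C(a,2) + C(b,2).
-- If K < n − 1 there is room for three new vertices: the first takes the largest C(c,2) ≤ r, and the
-- remainder, being less than c, is realised by a pair inside half of the clique.
-- If K = n − 1 the pair alone must realise every r ≤ C(K,2). Take the balanced sides b and a = b + d,
-- d ≤ 1, whose least value (overlap a + b ∸ K) lies at most b below r; moving j from b to a adds
-- j² + dj and the overlap absorbs the remaining y ≤ 2j + d. Since j ≈ √b, the overlap still fits
-- below the shrunken side once K ≥ 129.
module Submission where

open import Defs hiding (sym)
open import Data.Nat
open import Data.Nat.Properties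
open import Data.Nat.Combinatorics using (_C_; nCk+nC[k+1]≡[n+1]C[k+1]; nC1≡n)
open import Data.Nat.Tactic.RingSolver using (solve-∀)
open import Data.Bool using (Bool; true; false; _∧_; if_then_else_)
open import Data.Bool.Properties using (∧-zeroʳ) renaming (_≟_ to _≟ᵇ_)
open import Data.Fin using (Fin; zero; suc; toℕ)
open import Data.Vec.Functional using () renaming (_∷_ to _◂_)
open import Data.List using (List; []; _∷_; _++_; length; filter; concatMap; tabulate; [_]; allFin)
open import Data.Product using (Σ; ∃-syntax; _×_; _,_)
open import Data.Sum using (inj₁; inj₂)
open import Data.Empty using (⊥-elim)
open import Relation.Nullary using (yes; no)
open import Relation.Nullary.Decidable using (does)
open import Relation.Binary.PropositionalEquality using (_≡_; refl; sym; trans; cong; cong₂; subst; module ≡-Reasoning)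

-- Binomial coefficients

C₂ : ℕ → ℕ
C₂ zero = 0
C₂ (suc n) = n + C₂ n

C₃ : ℕ → ℕ
C₃ zero = 0
C₃ (suc n) = C₂ n + C₃ n

C₂-double : ∀ n → C₂ n + C₂ n + n ≡ n * n
C₂-double zero = refl
C₂-double (suc n) = begin
  (n + C₂ n) + (n + C₂ n) + suc n ≡⟨ regroup n (C₂ n) ⟩
  (C₂ n + C₂ n + n) + (n + n + 1) ≡⟨ cong (_+ (n + n + 1)) (C₂-double n) ⟩
  n * n + (n + n + 1)             ≡⟨ square-suc n ⟩
  suc n * suc n                   ∎
  where
  open ≡-Reasoning
  regroup : ∀ n c → (n + c) + (n + c) + suc n ≡ (c + c + n) + (n + n + 1)
  regroup = solve-∀
  square-suc : ∀ n → n * n + (n + n + 1) ≡ suc n * suc n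
  square-suc = solve-∀

C₂-+ : ∀ m n → C₂ (m + n) ≡ C₂ m + C₂ n + m * n
C₂-+ zero n = sym (+-identityʳ (C₂ n))
C₂-+ (suc m) n = trans (cong (m + n +_) (C₂-+ m n)) (regroup m n (C₂ m) (C₂ n))
  where
  regroup : ∀ m n p q → m + n + (p + q + m * n) ≡ m + p + q + suc m * n
  regroup = solve-∀

C₂-exchange : ∀ d j c →
  C₂ (d + (j + c) + j) + C₂ c ≡ C₂ (d + (j + c)) + C₂ (j + c) + (j * j + d * j)
C₂-exchange d j c = begin
  C₂ (a + j) + C₂ c                    ≡⟨ cong (_+ C₂ c) (C₂-+ a j) ⟩
  C₂ a + C₂ j + a * j + C₂ c           ≡⟨ regroup (C₂ a) (C₂ j) (C₂ c) d j c ⟩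
  C₂ a + (C₂ j + C₂ c + j * c) + (j * j + d * j) ≡⟨ cong (λ z → C₂ a + z + (j * j + d * j)) (sym (C₂-+ j c)) ⟩
  C₂ a + C₂ (j + c) + (j * j + d * j)  ∎
  where
  open ≡-Reasoning
  a = d + (j + c)
  regroup : ∀ p q r d j c →
    p + q + (d + (j + c)) * j + r ≡ p + (q + r + j * c) + (j * j + d * j)
  regroup = solve-∀

nC2≡C₂ : ∀ n → n C 2 ≡ C₂ n
nC2≡C₂ zero = refl
nC2≡C₂ (suc n) = trans (sym (nCk+nC[k+1]≡[n+1]C[k+1] n 1)) (cong₂ _+_ (nC1≡n n) (nC2≡C₂ n))

nC3≡C₃ : ∀ n → n C 3 ≡ C₃ n
nC3≡C₃ zero = refl
nC3≡C₃ (suc n) = trans (sym (nCk+nC[k+1]≡[n+1]C[k+1] n 2)) (cong₂ _+_ (nC2≡C₂ n) (nC3≡C₃ n))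

<-by : ∀ {m n} k → n ≡ suc (m + k) → m < n
<-by {m} k refl = s≤s (m≤m+n m k)

n≤n*n : ∀ n → n ≤ n * n
n≤n*n zero = z≤n
n≤n*n (suc n) = m≤m*n (suc n) (suc n)

m*m≤m*n⇒m≤n : ∀ m n → m * m ≤ m * n → m ≤ n
m*m≤m*n⇒m≤n zero n _ = z≤n
m*m≤m*n⇒m≤n (suc m) n le = *-cancelˡ-≤ (suc m) le

j²≤m⇒3j+1≤m : ∀ m j → 10 ≤ m → j * j ≤ m → 3 * j + 1 ≤ m
j²≤m⇒3j+1≤m m j 10≤m j²≤m with j ≤? 3
... | yes j≤3 = ≤-trans (+-monoˡ-≤ 1 (*-monoʳ-≤ 3 j≤3)) 10≤m
... | no j≰3 = ≤-trans (<⇒≤ 3j+1<4j) (≤-trans (*-monoˡ-≤ j (≰⇒> j≰3)) j²≤m)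
  where
  3j+1<4j : 3 * j + 1 < 4 * j
  3j+1<4j with m≤n⇒∃[o]m+o≡n (≰⇒> j≰3)
  ... | k , refl = <-by (2 + k) (expand k)
    where
    expand : ∀ k → 4 * (4 + k) ≡ suc (3 * (4 + k) + 1 + (2 + k))
    expand = solve-∀

-- If K ≤ x + 3j, then 2x² ≤ K² + K forces x ≤ 6j + 13, hence j ≤ 7 and K ≤ 76.
2x²≤K²+K⇒x+3j+1≤K : ∀ K x j → 129 ≤ K → j * j ≤ x → 2 * (x * x) ≤ K * K + K → x + 3 * j + 1 ≤ K
2x²≤K²+K⇒x+3j+1≤K K x j 129≤K j²≤x 2x²≤K²+K with x + 3 * j + 1 ≤? K
... | yes ok = ok
... | no fails = ⊥-elim (≤⇒≯ (≤-trans 129≤K K≤76) (≤ᵇ⇒≤ 77 129 _))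
  where
  open ≤-Reasoning
  K≤x+3j : K ≤ x + 3 * j
  K≤x+3j = s≤s⁻¹ (≤-trans (≰⇒> fails) (≤-reflexive (+-comm (x + 3 * j) 1)))
  double : ∀ x → x * x + x * x ≡ 2 * (x * x)
  double = solve-∀
  expand : ∀ x j → (x + 3 * j) * (x + 3 * j) + (x + 3 * j) ≡ x * x + x * (6 * j) + (9 * (j * j) + 3 * j) + x
  expand = solve-∀
  collect : ∀ x j → x * x + x * (6 * j) + (9 * x + 3 * x) + x ≡ x * x + x * (6 * j + 13)
  collect = solve-∀
  x²≤x[6j+13] : x * x ≤ x * (6 * j + 13)
  x²≤x[6j+13] = +-cancelˡ-≤ (x * x) (x * x) (x * (6 * j + 13)) (begin
    x * x + x * x                                   ≡⟨ double x ⟩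
    2 * (x * x)                                     ≤⟨ 2x²≤K²+K ⟩
    K * K + K                                       ≤⟨ +-mono-≤ (*-mono-≤ K≤x+3j K≤x+3j) K≤x+3j ⟩
    (x + 3 * j) * (x + 3 * j) + (x + 3 * j)         ≡⟨ expand x j ⟩
    x * x + x * (6 * j) + (9 * (j * j) + 3 * j) + x ≤⟨ +-monoˡ-≤ x (+-monoʳ-≤ (x * x + x * (6 * j))
                                                         (+-mono-≤ (*-monoʳ-≤ 9 j²≤x) (*-monoʳ-≤ 3 (≤-trans (n≤n*n j) j²≤x)))) ⟩
    x * x + x * (6 * j) + (9 * x + 3 * x) + x       ≡⟨ collect x j ⟩
    x * x + x * (6 * j + 13)                        ∎)
  x≤6j+13 : x ≤ 6 * j + 13
  x≤6j+13 = m*m≤m*n⇒m≤n x (6 * j + 13) x²≤x[6j+13]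
  j≤7 : j ≤ 7
  j≤7 with j ≤? 7
  ... | yes j≤7 = j≤7
  ... | no j≰7 with m≤n⇒∃[o]m+o≡n (≰⇒> j≰7)
  ... | k , refl = ⊥-elim (≤⇒≯ (≤-trans j²≤x x≤6j+13) (<-by (2 + 10 * k + k * k) (square k)))
    where
    square : ∀ k → (8 + k) * (8 + k) ≡ suc (6 * (8 + k) + 13 + (2 + 10 * k + k * k))
    square = solve-∀
  collect′ : ∀ j → 6 * j + 13 + 3 * j ≡ 9 * j + 13
  collect′ = solve-∀
  K≤76 : K ≤ 76
  K≤76 = begin
    K                   ≤⟨ K≤x+3j ⟩
    x + 3 * j           ≤⟨ +-monoˡ-≤ (3 * j) x≤6j+13 ⟩
    6 * j + 13 + 3 * j  ≡⟨ collect′ j ⟩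
    9 * j + 13          ≤⟨ +-monoˡ-≤ 13 (*-monoʳ-≤ 9 j≤7) ⟩
    76                  ∎

suc-m≤2n⇒m≤n² : ∀ m n → suc m ≤ n + n → m ≤ n * n
suc-m≤2n⇒m≤n² m (suc n) 1+m≤2+2n = ≤-trans (s≤s⁻¹ (≤-trans 1+m≤2+2n (≤-reflexive (+-suc (suc n) n))))
                                            (≤-trans (m≤m+n (suc (n + n)) (n * n)) (≤-reflexive (square n)))
  where
  square : ∀ n → suc (n + n) + n * n ≡ suc n * suc n
  square = solve-∀

discrete-ivt : ∀ (f : ℕ → ℕ) r B → f 0 ≤ r → r < f B → ∃[ x ] x < B × f x ≤ r × r < f (suc x)
discrete-ivt f r zero f0≤r r<f0 = ⊥-elim (≤⇒≯ f0≤r r<f0)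
discrete-ivt f r (suc B) f0≤r r<f[1+B] with r <? f B
... | yes r<fB = let x , x<B , fx≤r , r<f[1+x] = discrete-ivt f r B f0≤r r<fB
                 in x , m<n⇒m<1+n x<B , fx≤r , r<f[1+x]
... | no r≮fB = B , ≤-refl , ≮⇒≥ r≮fB , r<f[1+B]

C₃-decompose : ∀ n h → h ≤ C₃ (suc n) → ∃[ K ] ∃[ r ] K ≤ n × r ≤ C₂ K × C₃ K + r ≡ h
C₃-decompose n h h≤ with h <? C₃ (suc n)
... | no h≮ = n , C₂ n , ≤-refl , ≤-refl , trans (+-comm (C₃ n) (C₂ n)) (≤-antisym (≮⇒≥ h≮) h≤)
... | yes h< with discrete-ivt C₃ h (suc n) z≤n h<
... | K , K<1+n , C₃K≤h , h<C₃[1+K] with m≤n⇒∃[o]m+o≡n C₃K≤h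
... | r , refl = K , r , s≤s⁻¹ K<1+n , r≤C₂K , refl
  where
  r≤C₂K : r ≤ C₂ K
  r≤C₂K = +-cancelˡ-≤ (C₃ K) r (C₂ K) (≤-trans (<⇒≤ h<C₃[1+K]) (≤-reflexive (+-comm (C₂ K) (C₃ K))))

⌈n/2⌉≡d+⌊n/2⌋ : ∀ n → ∃[ d ] d ≤ 1 × ⌈ n /2⌉ ≡ d + ⌊ n /2⌋
⌈n/2⌉≡d+⌊n/2⌋ zero = 0 , z≤n , refl
⌈n/2⌉≡d+⌊n/2⌋ (suc zero) = 1 , s≤s z≤n , refl
⌈n/2⌉≡d+⌊n/2⌋ (suc (suc n)) with ⌈n/2⌉≡d+⌊n/2⌋ n
... | d , d≤1 , eq = d , d≤1 , trans (cong suc eq) (sym (+-suc d ⌊ n /2⌋))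

suc-∸-≤ : ∀ m n → suc m ∸ n ≤ suc (m ∸ n)
suc-∸-≤ m zero = ≤-refl
suc-∸-≤ zero (suc n) = ≤-trans (≤-reflexive (0∸n≡0 n)) z≤n
suc-∸-≤ (suc m) (suc n) = suc-∸-≤ m n

-- Splits

-- Sets of sizes a and b with s common elements fit in a K-set iff s ≤ a, s ≤ b and a + b ≤ K + s.
record Split (K r : ℕ) : Set where
  field
    a b s : ℕ
    s≤a : s ≤ a
    s≤b : s ≤ b
    a+b≤K+s : a + b ≤ K + s
    value : s + C₂ a + C₂ b ≡ r

split-small : ∀ A K r → A + A ≤ K → r ≤ A * A → Split K r
split-small zero K r _ r≤0 with n≤0⇒n≡0 r≤0
... | refl = record { a = 0 ; b = 0 ; s = 0 ; s≤a = z≤n ; s≤b = z≤n ; a+b≤K+s = z≤n ; value = refl }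
split-small (suc A) K r 2A+2≤K r≤[1+A]² with r ≤? A * A
... | yes r≤A² = split-small A K r (≤-trans (+-mono-≤ (n≤1+n A) (n≤1+n A)) 2A+2≤K) r≤A²
... | no r≰A² with m≤n⇒∃[o]m+o≡n (<⇒≤ (≰⇒> r≰A²))
... | t , refl with t ≤? A
... | yes t≤A = record
  { a = suc A ; b = A ; s = t ; s≤a = m≤n⇒m≤1+n t≤A ; s≤b = t≤A
  ; a+b≤K+s = ≤-trans (+-monoʳ-≤ (suc A) (n≤1+n A)) (≤-trans 2A+2≤K (m≤m+n K t))
  ; value = trans (regroup t A (C₂ A)) (cong (_+ t) (C₂-double A))
  }
  where
  regroup : ∀ t A c → t + (A + c) + c ≡ c + c + A + t
  regroup = solve-∀
... | no t≰A with m≤n⇒∃[o]m+o≡n (≰⇒> t≰A)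
... | t' , refl = record
  { a = suc A ; b = suc A ; s = suc t' ; s≤a = s≤s t'≤A ; s≤b = s≤s t'≤A
  ; a+b≤K+s = ≤-trans 2A+2≤K (m≤m+n K (suc t'))
  ; value = trans (regroup t' A (C₂ A)) (cong (λ z → z + suc (A + t')) (C₂-double A))
  }
  where
  regroup : ∀ t A c → suc t + (A + c) + (A + c) ≡ c + c + A + suc (A + t)
  regroup = solve-∀
  expand : ∀ A t → A * A + (suc A + t) ≡ A * A + A + suc t
  expand = solve-∀
  square : ∀ A → suc A * suc A ≡ A * A + A + suc A
  square = solve-∀
  t'≤A : t' ≤ A
  t'≤A = s≤s⁻¹ (+-cancelˡ-≤ (A * A + A) (suc t') (suc A)
           (≤-trans (≤-reflexive (sym (expand A t'))) (≤-trans r≤[1+A]² (≤-reflexive (square A)))))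

split-below : ∀ K r → suc r < K → Split K r
split-below K r 2+r≤K with ⌈n/2⌉≡d+⌊n/2⌋ K
... | d , d≤1 , ⌈K/2⌉≡ = split-small A K r 2A≤K (suc-m≤2n⇒m≤n² r A (s≤s⁻¹ (≤-trans 2+r≤K K≤1+2A)))
  where
  A = ⌊ K /2⌋
  K≡A+⌈K/2⌉ : A + ⌈ K /2⌉ ≡ K
  K≡A+⌈K/2⌉ = ⌊n/2⌋+⌈n/2⌉≡n K
  2A≤K : A + A ≤ K
  2A≤K = ≤-trans (+-monoʳ-≤ A (⌊n/2⌋≤⌈n/2⌉ K)) (≤-reflexive K≡A+⌈K/2⌉)
  K≤1+2A : K ≤ suc (A + A)
  K≤1+2A = ≤-trans (≤-reflexive (sym K≡A+⌈K/2⌉))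
                   (≤-trans (+-monoʳ-≤ A (≤-trans (≤-reflexive ⌈K/2⌉≡) (+-monoˡ-≤ A d≤1)))
                            (≤-reflexive (+-suc A A)))

split-greedy : ∀ K r → r ≤ C₂ K → ∃[ c ] ∃[ t ] c ≤ K × C₂ c + t ≡ r × Split K t
split-greedy K r r≤C₂K with r <? C₂ K
... | no r≮C₂K = K , 0 , ≤-refl , trans (+-identityʳ (C₂ K)) (≤-antisym (≮⇒≥ r≮C₂K) r≤C₂K) , split-small 0 K 0 z≤n z≤n
... | yes r<C₂K with discrete-ivt C₂ r K z≤n r<C₂K
... | c , c<K , C₂c≤r , r<C₂[1+c] with m≤n⇒∃[o]m+o≡n C₂c≤r
... | t , refl = c , t , <⇒≤ c<K , refl , split-below K t (<-≤-trans (s≤s t<c) c<K)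
  where
  t<c : t < c
  t<c = +-cancelˡ-< (C₂ c) t c (≤-trans r<C₂[1+c] (≤-reflexive (+-comm c (C₂ c))))

-- The least value s + C₂ a + C₂ b of a split of K with sides a and b: the overlap s is at least a + b ∸ K.
minValue : ℕ → ℕ → ℕ → ℕ
minValue K a b = C₂ a + C₂ b + (a + b ∸ K)

twice-square≤ : ∀ b d → d ≤ 1 → 2 * ((d + b) * (d + b)) ≤ (d + b) * (d + b) + (d + b) + (b * b + b)
twice-square≤ b zero z≤n = ≤-trans (m≤m+n (2 * (b * b)) (b + b)) (≤-reflexive (regroup b))
  where
  regroup : ∀ b → 2 * (b * b) + (b + b) ≡ b * b + b + (b * b + b)
  regroup = solve-∀
twice-square≤ b (suc zero) (s≤s z≤n) = ≤-reflexive (regroup b)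
  where
  regroup : ∀ b → 2 * (suc b * suc b) ≡ suc b * suc b + suc b + (b * b + b)
  regroup = solve-∀

minValue≤C₂⇒squares≤ : ∀ K a b → K ≤ a + b → minValue K a b ≤ C₂ K → a * a + a + (b * b + b) ≤ K * K + K
minValue≤C₂⇒squares≤ K a b K≤a+b min≤C₂K = begin
  a * a + a + (b * b + b)
    ≡⟨ cong₂ (λ x y → x + a + (y + b)) (sym (C₂-double a)) (sym (C₂-double b)) ⟩
  C₂ a + C₂ a + a + a + (C₂ b + C₂ b + b + b)
    ≡⟨ regroup (C₂ a) (C₂ b) a b ⟩
  2 * (C₂ a + C₂ b) + 2 * (a + b)
    ≡⟨ cong (λ z → 2 * (C₂ a + C₂ b) + 2 * z) (sym (m+[n∸m]≡n K≤a+b)) ⟩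
  2 * (C₂ a + C₂ b) + 2 * (K + u)
    ≡⟨ regroup′ (C₂ a + C₂ b) K u ⟩
  2 * minValue K a b + (K + K)
    ≤⟨ +-monoˡ-≤ (K + K) (*-monoʳ-≤ 2 min≤C₂K) ⟩
  2 * C₂ K + (K + K)
    ≡⟨ regroup″ (C₂ K) K ⟩
  C₂ K + C₂ K + K + K
    ≡⟨ cong (_+ K) (C₂-double K) ⟩
  K * K + K ∎
  where
  open ≤-Reasoning
  u = a + b ∸ K
  regroup : ∀ p q a b → p + p + a + a + (q + q + b + b) ≡ 2 * (p + q) + 2 * (a + b)
  regroup = solve-∀
  regroup′ : ∀ p K u → 2 * p + 2 * (K + u) ≡ 2 * (p + u) + (K + K)
  regroup′ = solve-∀
  regroup″ : ∀ c K → 2 * c + (K + K) ≡ c + c + K + K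
  regroup″ = solve-∀

exchange-room : ∀ K b d j → 129 ≤ K → 10 ≤ b → d ≤ 1 → j * j ≤ b →
  minValue K (d + b) b ≤ C₂ K → (d + b + b ∸ K) + 3 * j + 1 ≤ b
exchange-room K b d j 129≤K 10≤b d≤1 j²≤b min≤C₂K with d + b + b ≤? K
... | yes fits = ≤-trans (≤-reflexive (cong (λ u → u + 3 * j + 1) (m≤n⇒m∸n≡0 fits)))
                         (j²≤m⇒3j+1≤m b j 10≤b j²≤b)
... | no overflows = +-cancelˡ-≤ K (u + 3 * j + 1) b (begin
  K + (u + 3 * j + 1)       ≡⟨ regroup K u j ⟩
  K + u + (3 * j + 1)       ≡⟨ cong (_+ (3 * j + 1)) (m+[n∸m]≡n K≤a+b) ⟩
  a + b + (3 * j + 1)       ≡⟨ regroup′ a b j ⟩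
  b + (a + 3 * j + 1)       ≤⟨ +-monoʳ-≤ b a+3j+1≤K ⟩
  b + K                     ≡⟨ +-comm b K ⟩
  K + b                     ∎)
  where
  open ≤-Reasoning
  a = d + b
  u = a + b ∸ K
  K≤a+b : K ≤ a + b
  K≤a+b = <⇒≤ (≰⇒> overflows)
  a+3j+1≤K : a + 3 * j + 1 ≤ K
  a+3j+1≤K = 2x²≤K²+K⇒x+3j+1≤K K a j 129≤K (≤-trans j²≤b (m≤n+m b d))
    (≤-trans (twice-square≤ b d d≤1) (minValue≤C₂⇒squares≤ K a b K≤a+b min≤C₂K))
  regroup : ∀ K u j → K + (u + 3 * j + 1) ≡ K + u + (3 * j + 1)
  regroup = solve-∀
  regroup′ : ∀ a b j → a + b + (3 * j + 1) ≡ b + (a + 3 * j + 1)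
  regroup′ = solve-∀

-- Moving j from side b₀ = j + c to side a₀ = d + b₀ raises C₂ a₀ + C₂ b₀ by j² + dj (C₂-exchange);
-- the rest y of r is put into the overlap, which the room hypothesis keeps below the new side c.
exchange-split : ∀ K d j c y → d ≤ 1 → y ≤ j + j + d →
  (d + (j + c) + (j + c) ∸ K) + 3 * j + 1 ≤ j + c →
  Split K (minValue K (d + (j + c)) (j + c) + (j * j + d * j + y))
exchange-split K d j c y d≤1 y≤2j+d room = record
  { a = a₀ + j ; b = c ; s = u + y
  ; s≤a = ≤-trans s≤c (≤-trans (m≤n+m c j) (≤-trans (m≤n+m b₀ d) (m≤m+n a₀ j)))
  ; s≤b = s≤c
  ; a+b≤K+s = ≤-trans (≤-reflexive (same-total d j c)) (≤-trans (m≤n+m∸n (a₀ + b₀) K) (+-monoʳ-≤ K (m≤m+n u y)))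
  ; value = trans (+-assoc (u + y) (C₂ (a₀ + j)) (C₂ c))
                  (trans (cong ((u + y) +_) (C₂-exchange d j c)) (regroup (C₂ a₀) (C₂ b₀) u y (j * j + d * j)))
  }
  where
  b₀ = j + c
  a₀ = d + b₀
  u = a₀ + b₀ ∸ K
  same-total : ∀ d j c → d + (j + c) + j + c ≡ d + (j + c) + (j + c)
  same-total = solve-∀
  regroup : ∀ p q u y Q → (u + y) + (p + q + Q) ≡ p + q + u + (Q + y)
  regroup = solve-∀
  split-room : ∀ u j → u + 3 * j + 1 ≡ j + (u + (j + j + 1))
  split-room = solve-∀
  s≤c : u + y ≤ c
  s≤c = ≤-trans (+-monoʳ-≤ u (≤-trans y≤2j+d (+-monoʳ-≤ (j + j) d≤1)))
                (+-cancelˡ-≤ j (u + (j + j + 1)) c (≤-trans (≤-reflexive (sym (split-room u j))) room))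

split-exchange : ∀ K b d r → 129 ≤ K → 10 ≤ b → d ≤ 1 →
  minValue K (d + b) b ≤ r → r ≤ minValue K (d + b) b + b → r ≤ C₂ K → Split K r
split-exchange K b d r 129≤K 10≤b d≤1 min≤r r≤min+b r≤C₂K with m≤n⇒∃[o]m+o≡n min≤r
... | X , refl with discrete-ivt f X (suc X) (≤-trans (≤-reflexive (*-zeroʳ d)) z≤n) X<f[1+X]
  where
  f : ℕ → ℕ
  f j = j * j + d * j
  X<f[1+X] : X < f (suc X)
  X<f[1+X] = ≤-trans (n≤n*n (suc X)) (m≤m+n _ _)
... | j , _ , fj≤X , X<f[1+j] with m≤n⇒∃[o]m+o≡n fj≤X
... | y , refl with m≤n⇒∃[o]m+o≡n (≤-trans (n≤n*n j) (≤-trans (m≤m+n (j * j) (d * j)) (≤-trans (m≤m+n _ y) X≤b)))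
  where
  X≤b : j * j + d * j + y ≤ b
  X≤b = +-cancelˡ-≤ (minValue K (d + b) b) _ _ r≤min+b
... | c , refl = exchange-split K d j c y d≤1 y≤2j+d
                   (exchange-room K (j + c) d j 129≤K 10≤b d≤1 j²≤b (≤-trans (m≤m+n _ _) r≤C₂K))
  where
  expand : ∀ j d → suc j * suc j + d * suc j ≡ suc (j * j + d * j + (j + j + d))
  expand = solve-∀
  y≤2j+d : y ≤ j + j + d
  y≤2j+d = s≤s⁻¹ (+-cancelˡ-≤ (j * j + d * j) (suc y) _
             (≤-trans (≤-reflexive (+-suc (j * j + d * j) y)) (≤-trans X<f[1+j] (≤-reflexive (trans (expand j d) (sym (+-suc _ _)))))))
  j²≤b : j * j ≤ j + c
  j²≤b = ≤-trans (m≤m+n (j * j) (d * j)) (≤-trans (m≤m+n _ y) (+-cancelˡ-≤ (minValue K (d + (j + c)) (j + c)) _ _ r≤min+b))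

staircase : ℕ → ℕ → ℕ
staircase K t = minValue K ⌈ t /2⌉ ⌊ t /2⌋

staircase-step : ∀ K t → staircase K (suc t) ≤ staircase K t + suc ⌊ t /2⌋
staircase-step K t = ≤-trans
  (+-monoʳ-≤ (C₂ (suc f) + C₂ c) (≤-trans (suc-∸-≤ (f + c) K) (≤-reflexive (cong (λ z → suc (z ∸ K)) (+-comm f c)))))
  (≤-reflexive (regroup f (C₂ f) (C₂ c) (c + f ∸ K)))
  where
  f = ⌊ t /2⌋
  c = ⌈ t /2⌉
  regroup : ∀ f p q u → f + p + q + suc u ≡ q + p + u + suc f
  regroup = solve-∀

pair-bound : ∀ b d → d ≤ 1 → C₂ (d + b) + C₂ b + b ≤ b * b + b
pair-bound b zero z≤n = ≤-trans (≤-reflexive (C₂-double b)) (m≤m+n (b * b) b)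
pair-bound b (suc zero) (s≤s z≤n) = ≤-reflexive (trans (regroup b (C₂ b)) (cong (_+ b) (C₂-double b)))
  where
  regroup : ∀ b c → b + c + c + b ≡ c + c + b + b
  regroup = solve-∀

split-balanced : ∀ K b d r → 129 ≤ K → d ≤ 1 →
  minValue K (d + b) b ≤ r → r ≤ minValue K (d + b) b + b → r ≤ C₂ K → Split K r
split-balanced K b d r 129≤K d≤1 min≤r r≤min+b r≤C₂K with 10 ≤? b
... | yes 10≤b = split-exchange K b d r 129≤K 10≤b d≤1 min≤r r≤min+b r≤C₂K
... | no b≱10 = split-small 10 K r (≤-trans (≤ᵇ⇒≤ 20 129 _) 129≤K) (begin
  r                                       ≤⟨ r≤min+b ⟩
  C₂ (d + b) + C₂ b + (d + b + b ∸ K) + b ≡⟨ cong (λ u → C₂ (d + b) + C₂ b + u + b) (m≤n⇒m∸n≡0 fits) ⟩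
  C₂ (d + b) + C₂ b + 0 + b               ≡⟨ cong (_+ b) (+-identityʳ _) ⟩
  C₂ (d + b) + C₂ b + b                   ≤⟨ pair-bound b d d≤1 ⟩
  b * b + b                               ≤⟨ +-mono-≤ (*-mono-≤ b≤9 b≤9) b≤9 ⟩
  90                                      ≤⟨ ≤ᵇ⇒≤ 90 100 _ ⟩
  100                                     ∎)
  where
  open ≤-Reasoning
  b≤9 : b ≤ 9
  b≤9 = s≤s⁻¹ (≰⇒> b≱10)
  fits : d + b + b ≤ K
  fits = ≤-trans (+-mono-≤ (+-mono-≤ d≤1 b≤9) b≤9) (≤-trans (≤ᵇ⇒≤ 19 129 _) 129≤K)

split-large : ∀ K r → 129 ≤ K → r ≤ C₂ K → Split K r
split-large K r 129≤K r≤C₂K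
  with discrete-ivt (staircase K) r (K + suc r) (≤-trans (≤-reflexive (0∸n≡0 K)) z≤n) r<top
  where
  t≡ : ⌈ K + suc r /2⌉ + ⌊ K + suc r /2⌋ ≡ K + suc r
  t≡ = trans (+-comm ⌈ K + suc r /2⌉ _) (⌊n/2⌋+⌈n/2⌉≡n (K + suc r))
  r<top : r < staircase K (K + suc r)
  r<top = ≤-trans (≤-reflexive (trans (sym (m+n∸m≡n K (suc r))) (cong (_∸ K) (sym t≡)))) (m≤n+m _ _)
... | t , _ , low , high with ⌈n/2⌉≡d+⌊n/2⌋ t
... | d , d≤1 , ⌈t/2⌉≡ = split-balanced K ⌊ t /2⌋ d r 129≤K d≤1
  (subst (λ a → minValue K a ⌊ t /2⌋ ≤ r) ⌈t/2⌉≡ low)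
  (subst (λ a → r ≤ minValue K a ⌊ t /2⌋ + ⌊ t /2⌋) ⌈t/2⌉≡
         (s≤s⁻¹ (≤-trans high (≤-trans (staircase-step K t) (≤-reflexive (+-suc _ ⌊ t /2⌋))))))
  r≤C₂K

-- Counting triangles

𝟙 : Bool → ℕ
𝟙 true = 1
𝟙 false = 0

countᵇ : {A : Set} → (A → Bool) → List A → ℕ
countᵇ p [] = 0
countᵇ p (x ∷ xs) = 𝟙 (p x) + countᵇ p xs

length-filter≡countᵇ : {A : Set} (p : A → Bool) (xs : List A) →
  length (filter (λ x → p x ≟ᵇ true) xs) ≡ countᵇ p xs
length-filter≡countᵇ p [] = refl
length-filter≡countᵇ p (x ∷ xs) with p x
... | true = cong suc (length-filter≡countᵇ p xs)
... | false = length-filter≡countᵇ p xs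

countᵇ-++ : {A : Set} (p : A → Bool) (xs ys : List A) →
  countᵇ p (xs ++ ys) ≡ countᵇ p xs + countᵇ p ys
countᵇ-++ p [] ys = refl
countᵇ-++ p (x ∷ xs) ys =
  trans (cong (𝟙 (p x) +_) (countᵇ-++ p xs ys)) (sym (+-assoc (𝟙 (p x)) _ _))

countᵇ-if : {A : Set} (p : A → Bool) (c : Bool) (x : A) →
  countᵇ p (if c then [ x ] else []) ≡ 𝟙 (c ∧ p x)
countᵇ-if p true x = +-identityʳ _
countᵇ-if p false x = refl

sumFin : ∀ {m} → (Fin m → ℕ) → ℕ
sumFin {zero} f = 0
sumFin {suc m} f = f zero + sumFin (λ i → f (suc i))

sumFin-cong : ∀ {m} {f g : Fin m → ℕ} → (∀ i → f i ≡ g i) → sumFin f ≡ sumFin g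
sumFin-cong {zero} eq = refl
sumFin-cong {suc m} eq = cong₂ _+_ (eq zero) (sumFin-cong (λ i → eq (suc i)))

sumFin-zero : ∀ m → sumFin {m} (λ _ → 0) ≡ 0
sumFin-zero zero = refl
sumFin-zero (suc m) = sumFin-zero m

countᵇ-concatMap-tabulate : ∀ {A B : Set} {m} (p : B → Bool) (g : Fin m → A) (f : A → List B) →
  countᵇ p (concatMap f (tabulate g)) ≡ sumFin (λ i → countᵇ p (f (g i)))
countᵇ-concatMap-tabulate {m = zero} p g f = refl
countᵇ-concatMap-tabulate {m = suc m} p g f =
  trans (countᵇ-++ p (f (g zero)) _)
        (cong (countᵇ p (f (g zero)) +_) (countᵇ-concatMap-tabulate p (λ i → g (suc i)) f))

_<ᶠ_ : ∀ {m} → Fin m → Fin m → Bool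
i <ᶠ j = toℕ i <ᵇ toℕ j

triangleCount : ∀ {m} → Graph m → ℕ
triangleCount G = sumFin λ i → sumFin λ j → sumFin λ k →
  𝟙 ((i <ᶠ j ∧ j <ᶠ k) ∧ isTriangle G (i , j , k))

subK3≡triangleCount : ∀ {m} (G : Graph m) → subK3 G ≡ triangleCount G
subK3≡triangleCount {m} G =
  trans (length-filter≡countᵇ (isTriangle G) (triples m))
  (trans (count-allFin outer)
  (sumFin-cong λ i → trans (count-allFin (middle i))
  (sumFin-cong λ j → trans (count-allFin (inner i j))
  (sumFin-cong λ k → countᵇ-if (isTriangle G) (i <ᶠ j ∧ j <ᶠ k) (i , j , k)))))
  where
  Triple = Fin m × Fin m × Fin m
  count-allFin : (f : Fin m → List Triple) →
    countᵇ (isTriangle G) (concatMap f (allFin m)) ≡ sumFin (λ i → countᵇ (isTriangle G) (f i))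
  count-allFin = countᵇ-concatMap-tabulate (isTriangle G) (λ i → i)
  inner : Fin m → Fin m → Fin m → List Triple
  inner i j k = if does (toℕ i <? toℕ j) ∧ does (toℕ j <? toℕ k) then [ (i , j , k) ] else []
  middle : Fin m → Fin m → List Triple
  middle i j = concatMap (inner i j) (allFin m)
  outer : Fin m → List Triple
  outer i = concatMap (middle i) (allFin m)

extend : ∀ {m} → (Fin m → Bool) → Graph m → Graph (suc m)
extend {m} N G = record { adj = A ; sym = A-sym ; irrefl = A-irrefl }
  where
  A : Fin (suc m) → Fin (suc m) → Bool
  A zero zero = false
  A zero (suc j) = N j
  A (suc i) zero = N i
  A (suc i) (suc j) = adj G i j
  A-sym : ∀ i j → A i j ≡ A j i
  A-sym zero zero = refl
  A-sym zero (suc j) = refl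
  A-sym (suc i) zero = refl
  A-sym (suc i) (suc j) = Graph.sym G i j
  A-irrefl : ∀ i → A i i ≡ false
  A-irrefl zero = refl
  A-irrefl (suc i) = irrefl G i

edgesWithin : ∀ {m} → Graph m → (Fin m → Bool) → ℕ
edgesWithin G N = sumFin λ j → sumFin λ k → 𝟙 (j <ᶠ k ∧ (N j ∧ (adj G j k ∧ N k)))

triangleCount-extend : ∀ {m} (N : Fin m → Bool) (G : Graph m) →
  triangleCount (extend N G) ≡ edgesWithin G N + triangleCount G
triangleCount-extend {m} N G = cong₂ _+_
  (cong (_+ edgesWithin G N) (sumFin-zero (suc m)))
  (sumFin-cong λ i → cong₂ _+_ (sumFin-zero (suc m)) (sumFin-cong λ j →
    cong (_+ sumFin (λ k → 𝟙 ((i <ᶠ j ∧ j <ᶠ k) ∧ isTriangle G (i , j , k))))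
         (no-triangle (i <ᶠ j) _)))
  where
  no-triangle : ∀ b c → 𝟙 ((b ∧ false) ∧ c) ≡ 0
  no-triangle true c = refl
  no-triangle false c = refl

size : ∀ {m} → (Fin m → Bool) → ℕ
size N = sumFin (λ k → 𝟙 (N k))

clique : ∀ K → Graph K
clique zero = record { adj = λ () ; sym = λ () ; irrefl = λ () }
clique (suc K) = extend (λ _ → true) (clique K)

edgesWithin-clique : ∀ K (N : Fin K → Bool) → edgesWithin (clique K) N ≡ C₂ (size N)
edgesWithin-clique zero N = refl
edgesWithin-clique (suc K) N with N zero
... | true = cong (size (λ k → N (suc k)) +_) (edgesWithin-clique K (λ k → N (suc k)))
... | false = cong₂ _+_ (sumFin-zero K) (edgesWithin-clique K (λ k → N (suc k)))

size-all : ∀ K → size {K} (λ _ → true) ≡ K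
size-all zero = refl
size-all (suc K) = cong suc (size-all K)

triangleCount-clique : ∀ K → triangleCount (clique K) ≡ C₃ K
triangleCount-clique zero = refl
triangleCount-clique (suc K) = begin
  triangleCount (clique (suc K))                  ≡⟨ triangleCount-extend (λ _ → true) (clique K) ⟩
  edgesWithin (clique K) (λ _ → true) + triangleCount (clique K)
    ≡⟨ cong₂ _+_ (trans (edgesWithin-clique K _) (cong C₂ (size-all K))) (triangleCount-clique K) ⟩
  C₂ K + C₃ K                                     ∎
  where open ≡-Reasoning

addIsolated : ∀ {m} L → Graph m → Graph (L + m)
addIsolated zero G = G
addIsolated (suc L) G = extend (λ _ → false) (addIsolated L G)

edgesWithin-none : ∀ {m} (G : Graph m) → edgesWithin G (λ _ → false) ≡ 0
edgesWithin-none {m} G = trans (sumFin-cong row) (sumFin-zero m)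
  where
  row : ∀ j → sumFin (λ k → 𝟙 (j <ᶠ k ∧ (false ∧ (adj G j k ∧ false)))) ≡ 0
  row j = trans (sumFin-cong λ k → cong 𝟙 (∧-zeroʳ (j <ᶠ k))) (sumFin-zero m)

triangleCount-addIsolated : ∀ {m} L (G : Graph m) → triangleCount (addIsolated L G) ≡ triangleCount G
triangleCount-addIsolated zero G = refl
triangleCount-addIsolated (suc L) G =
  trans (triangleCount-extend (λ _ → false) (addIsolated L G))
        (cong₂ _+_ (edgesWithin-none (addIsolated L G)) (triangleCount-addIsolated L G))

countBelow : ℕ → (ℕ → Bool) → ℕ
countBelow zero f = 0
countBelow (suc m) f = 𝟙 (f 0) + countBelow m (λ x → f (suc x))

size-toℕ : ∀ m (f : ℕ → Bool) → size {m} (λ k → f (toℕ k)) ≡ countBelow m f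
size-toℕ zero f = refl
size-toℕ (suc m) f = cong (𝟙 (f 0) +_) (size-toℕ m (λ x → f (suc x)))

countBelow-cong : ∀ m {f g : ℕ → Bool} → (∀ x → f x ≡ g x) → countBelow m f ≡ countBelow m g
countBelow-cong zero eq = refl
countBelow-cong (suc m) eq = cong₂ _+_ (cong 𝟙 (eq 0)) (countBelow-cong m (λ x → eq (suc x)))

countBelow-none : ∀ m → countBelow m (λ _ → false) ≡ 0
countBelow-none zero = refl
countBelow-none (suc m) = countBelow-none m

inRange : ℕ → ℕ → ℕ → Bool
inRange zero len x = x <ᵇ len
inRange (suc lo) len zero = false
inRange (suc lo) len (suc x) = inRange lo len x

countBelow-<ᵇ : ∀ m len → len ≤ m → countBelow m (_<ᵇ len) ≡ len
countBelow-<ᵇ zero zero _ = refl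
countBelow-<ᵇ (suc m) zero _ = countBelow-none m
countBelow-<ᵇ (suc m) (suc len) (s≤s len≤m) = cong suc (countBelow-<ᵇ m len len≤m)

countBelow-inRange : ∀ m lo len → lo + len ≤ m → countBelow m (inRange lo len) ≡ len
countBelow-inRange m zero len le = countBelow-<ᵇ m len le
countBelow-inRange (suc m) (suc lo) len (s≤s le) = countBelow-inRange m lo len le

<ᵇ-∧-<ᵇ : ∀ x s a → s ≤ a → ((x <ᵇ s) ∧ (x <ᵇ a)) ≡ (x <ᵇ s)
<ᵇ-∧-<ᵇ zero zero a _ = refl
<ᵇ-∧-<ᵇ zero (suc s) (suc a) _ = refl
<ᵇ-∧-<ᵇ (suc x) zero a _ = refl
<ᵇ-∧-<ᵇ (suc x) (suc s) (suc a) (s≤s s≤a) = <ᵇ-∧-<ᵇ x s a s≤a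

inRange-∩ : ∀ lo s a b x → lo + s ≡ b → s ≤ a →
  ((x <ᵇ b) ∧ inRange lo a x) ≡ inRange lo s x
inRange-∩ zero s a b x refl s≤a = <ᵇ-∧-<ᵇ x s a s≤a
inRange-∩ (suc lo) s a b zero eq s≤a = ∧-zeroʳ (0 <ᵇ b)
inRange-∩ (suc lo) s a (suc b) (suc x) eq s≤a = inRange-∩ lo s a b x (suc-injective eq) s≤a

-- Vertex 0 is joined to vertex 1 and to the clique vertices [lo, lo + a); vertex 1 to those in [0, b).
twoVertexGraph : ∀ K lo a b → Graph (2 + K)
twoVertexGraph K lo a b =
  extend (true ◂ λ k → inRange lo a (toℕ k)) (extend (λ k → toℕ k <ᵇ b) (clique K))

triangleCount-twoVertexGraph : ∀ K lo a b s → lo + s ≡ b → s ≤ a → lo + a ≤ K →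
  triangleCount (twoVertexGraph K lo a b) ≡ s + C₂ a + (C₂ b + C₃ K)
triangleCount-twoVertexGraph K lo a b s lo+s≡b s≤a lo+a≤K = begin
  triangleCount (twoVertexGraph K lo a b)
    ≡⟨ triangleCount-extend P (extend Q (clique K)) ⟩
  (size (λ k → Q k ∧ P (suc k)) + edgesWithin (clique K) (λ k → P (suc k)))
    + triangleCount (extend Q (clique K))
    ≡⟨ cong₂ _+_ (cong₂ _+_ common p-clique) (triangleCount-extend Q (clique K)) ⟩
  s + C₂ a + (edgesWithin (clique K) Q + triangleCount (clique K))
    ≡⟨ cong (s + C₂ a +_) (cong₂ _+_ q-clique (triangleCount-clique K)) ⟩
  s + C₂ a + (C₂ b + C₃ K) ∎
  where
  open ≡-Reasoning
  P = true ◂ λ k → inRange lo a (toℕ k)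
  Q = λ (k : Fin K) → toℕ k <ᵇ b
  b≤K : b ≤ K
  b≤K = ≤-trans (≤-reflexive (sym lo+s≡b)) (≤-trans (+-monoʳ-≤ lo s≤a) lo+a≤K)
  common : size (λ k → Q k ∧ P (suc k)) ≡ s
  common = begin
    size (λ k → Q k ∧ P (suc k))                  ≡⟨ size-toℕ K _ ⟩
    countBelow K (λ x → (x <ᵇ b) ∧ inRange lo a x) ≡⟨ countBelow-cong K (λ x → inRange-∩ lo s a b x lo+s≡b s≤a) ⟩
    countBelow K (inRange lo s)                    ≡⟨ countBelow-inRange K lo s (≤-trans (+-monoʳ-≤ lo s≤a) lo+a≤K) ⟩
    s ∎
  p-clique : edgesWithin (clique K) (λ k → P (suc k)) ≡ C₂ a
  p-clique = trans (edgesWithin-clique K _)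
                   (cong C₂ (trans (size-toℕ K (inRange lo a)) (countBelow-inRange K lo a lo+a≤K)))
  q-clique : edgesWithin (clique K) Q ≡ C₂ b
  q-clique = trans (edgesWithin-clique K Q)
                   (cong C₂ (trans (size-toℕ K (_<ᵇ b)) (countBelow-<ᵇ K b b≤K)))

-- The new vertex sees the clique vertices [0, c), which sit at positions 2, 3, … of twoVertexGraph.
threeVertexGraph : ∀ K lo a b c → Graph (3 + K)
threeVertexGraph K lo a b c = extend (λ k → inRange 2 c (toℕ k)) (twoVertexGraph K lo a b)

triangleCount-threeVertexGraph : ∀ K lo a b c s → lo + s ≡ b → s ≤ a → lo + a ≤ K → c ≤ K →
  triangleCount (threeVertexGraph K lo a b c) ≡ C₂ c + (s + C₂ a + (C₂ b + C₃ K))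
triangleCount-threeVertexGraph K lo a b c s lo+s≡b s≤a lo+a≤K c≤K =
  trans (triangleCount-extend W (twoVertexGraph K lo a b))
        (cong₂ _+_ w-edges (triangleCount-twoVertexGraph K lo a b s lo+s≡b s≤a lo+a≤K))
  where
  W = λ (k : Fin (2 + K)) → inRange 2 c (toℕ k)
  w-edges : edgesWithin (twoVertexGraph K lo a b) W ≡ C₂ c
  w-edges = cong₂ _+_ (sumFin-zero (suc K)) (cong₂ _+_ (sumFin-zero K)
    (trans (edgesWithin-clique K (λ k → toℕ k <ᵇ c))
           (cong C₂ (trans (size-toℕ K (_<ᵇ c)) (countBelow-<ᵇ K c c≤K)))))

TriangleGraph : ℕ → ℕ → Set
TriangleGraph m h = Σ (Graph m) (λ G → subK3 G ≡ h)

module _ {K r} (σ : Split K r) where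
  open Split σ

  private
    lo = b ∸ s
    lo+s≡b : lo + s ≡ b
    lo+s≡b = m∸n+n≡m s≤b
    lo+a≤K : lo + a ≤ K
    lo+a≤K = +-cancelʳ-≤ s (lo + a) K (≤-trans (≤-reflexive (regroup lo a s)) (≤-trans (≤-reflexive (cong (a +_) lo+s≡b)) a+b≤K+s))
      where
      regroup : ∀ lo a s → lo + a + s ≡ a + (lo + s)
      regroup = solve-∀

  split-graph : TriangleGraph (2 + K) (C₃ K + r)
  split-graph = twoVertexGraph K lo a b , (begin
    subK3 (twoVertexGraph K lo a b)         ≡⟨ subK3≡triangleCount (twoVertexGraph K lo a b) ⟩
    triangleCount (twoVertexGraph K lo a b) ≡⟨ triangleCount-twoVertexGraph K lo a b s lo+s≡b s≤a lo+a≤K ⟩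
    s + C₂ a + (C₂ b + C₃ K)                ≡⟨ regroup (s + C₂ a) (C₂ b) (C₃ K) ⟩
    C₃ K + (s + C₂ a + C₂ b)                ≡⟨ cong (C₃ K +_) value ⟩
    C₃ K + r                                ∎)
    where
    open ≡-Reasoning
    regroup : ∀ x y z → x + (y + z) ≡ z + (x + y)
    regroup = solve-∀

  split-graph-with-clique : ∀ c → c ≤ K → TriangleGraph (3 + K) (C₃ K + (C₂ c + r))
  split-graph-with-clique c c≤K = threeVertexGraph K lo a b c , (begin
    subK3 (threeVertexGraph K lo a b c)         ≡⟨ subK3≡triangleCount (threeVertexGraph K lo a b c) ⟩
    triangleCount (threeVertexGraph K lo a b c) ≡⟨ triangleCount-threeVertexGraph K lo a b c s lo+s≡b s≤a lo+a≤K c≤K ⟩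
    C₂ c + (s + C₂ a + (C₂ b + C₃ K))           ≡⟨ regroup (C₂ c) (s + C₂ a) (C₂ b) (C₃ K) ⟩
    C₃ K + (C₂ c + (s + C₂ a + C₂ b))           ≡⟨ cong (λ z → C₃ K + (C₂ c + z)) value ⟩
    C₃ K + (C₂ c + r)                           ∎)
    where
    open ≡-Reasoning
    regroup : ∀ w x y z → w + (x + (y + z)) ≡ z + (w + (x + y))
    regroup = solve-∀

subK3-subst : ∀ {m m'} (eq : m ≡ m') (G : Graph m) → subK3 (subst Graph eq G) ≡ subK3 G
subK3-subst refl G = refl

pad : ∀ {m m' h} → m ≤ m' → TriangleGraph m h → TriangleGraph m' h
pad {m} m≤m' (G , count) with m≤n⇒∃[o]m+o≡n m≤m'
... | L , refl = subst Graph (+-comm L m) (addIsolated L G) ,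
  trans (subK3-subst (+-comm L m) (addIsolated L G))
        (trans (subK3≡triangleCount (addIsolated L G))
               (trans (triangleCount-addIsolated L G) (trans (sym (subK3≡triangleCount G)) count)))

theorem19 : (n : ℕ) → 130 ≤ n → (h : ℕ) → h ≤ n C 3 →
    Σ (Graph (suc n)) (λ G → subK3 G ≡ h)
theorem19 (suc n) (s≤s 129≤n) h h≤nC3 with C₃-decompose n h (subst (h ≤_) (nC3≡C₃ (suc n)) h≤nC3)
... | K , r , K≤n , r≤C₂K , refl with m≤n⇒m<n∨m≡n K≤n
... | inj₂ refl = split-graph (split-large K r 129≤n r≤C₂K)
... | inj₁ K<n with split-greedy K r r≤C₂K
... | c , t , c≤K , refl , σ = pad (s≤s (s≤s K<n)) (split-graph-with-clique σ c c≤K)
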